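{- Let $k\ge 1$ be an integer and let $G$ be a finite simple graph of order $n$. If $k\ge 2^n$, then $d_R^k(G)=2^n$.
   Context: A Roman $k$-dominating function (RkDF) on a graph $G$ is a map $f:V(G)\to\{0,1,2\}$ such that every vertex $v$ with $f(v)=0$ has at least $k$ neighbors $u$ with $f(u)=2$. A set $\{f_1,\ldots,f_d\}$ of pairwise distinct RkDFs on $G$ with $\sum_{i=1}^d f_i(v)\le 2k$ for every $v\in V(G)$ is a Roman $(k,k)$-dominating family on $G$; the maximum number of functions in such a family is the Roman $(k,k)$-domatic number $d_R^k(G)$. -}

module Defs where

open import Data.Nat using (ℕ; zero; suc; _+_; _*_; _^_; _≤_)
open import Data.Bool using (Bool; true; false; _∧_; if_then_else_)
open import Data.Fin using (Fin; zero; suc)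
open import Data.List using (List; length; map; allFin)
open import Data.Nat.ListAction using (sum)
open import Data.List.Relation.Unary.AllPairs using (AllPairs)
open import Data.Empty using (⊥)
open import Data.List.Relation.Unary.All using (All)
open import Relation.Binary.PropositionalEquality using (_≡_)
open import Data.Product using (Σ; _×_)

record Graph (n : ℕ) : Set where
  field
    adj    : Fin n → Fin n → Bool
    sym    : ∀ u v → adj u v ≡ adj v u
    irrefl : ∀ v → adj v v ≡ false
open Graph public

Labeling : ℕ → Set
Labeling n = Fin n → Fin 3

val : Fin 3 → ℕ
val zero = 0
val (suc zero) = 1
val (suc (suc zero)) = 2

isTwo : Fin 3 → Bool
isTwo (suc (suc zero)) = true
isTwo _ = false

twoNeighbours : ∀ {n} → Graph n → Labeling n → Fin n → ℕ
twoNeighbours G f v =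
  sum (map (λ u → if adj G v u ∧ isTwo (f u) then 1 else 0) (allFin _))

IsRkDF : ∀ {n} → ℕ → Graph n → Labeling n → Set
IsRkDF k G f = ∀ v → f v ≡ zero → k ≤ twoNeighbours G f v

Distinct : ∀ {n} → Labeling n → Labeling n → Set
Distinct f g = Σ _ λ v → f v ≡ g v → ⊥

IsRkkFamily : ∀ {n} → ℕ → Graph n → List (Labeling n) → Set
IsRkkFamily k G fs =
  All (IsRkDF k G) fs ×
  AllPairs Distinct fs ×
  (∀ v → sum (map (λ f → val (f v)) fs) ≤ 2 * k)

RomanKKDomaticNumberIs : ∀ {n} → ℕ → Graph n → ℕ → Set
RomanKKDomaticNumberIs k G d =
  (Σ (List (Labeling _)) λ fs → IsRkkFamily k G fs × length fs ≡ d) ×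
  (∀ fs → IsRkkFamily k G fs → length fs ≤ d)

module Submission where

-- Since n < 2 ^ n ≤ k, a vertex has fewer than k neighbours
-- at all, so no vertex of an RkDF can carry the label 0: the RkDFs on G
-- are exactly the labelings that avoid 0 ("zero-free" labelings), i.e.
-- the maps V(G) → {1,2}.
--   * Upper bound: pairwise distinct zero-free labelings of n vertices
--     number at most 2 ^ n.  By induction on n, split a family by the
--     label of the first vertex (1 or 2); each part restricts to a family
--     of pairwise distinct zero-free labelings of the remaining n - 1
--     vertices.
--   * Lower bound: the list of all 2 ^ n zero-free labelings is a
--     Roman (k,k)-dominating family; every vertex sum is at most
--     2 · 2 ^ n ≤ 2k.

open import Defs hiding (sym)
open import Data.Nat using (ℕ; _≤_; _<_; _^_; zero; suc; _+_; _*_; z≤n; s≤s)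
open import Data.Nat.Properties
  using (+-mono-≤; +-monoʳ-<; +-monoˡ-≤; +-identityʳ; +-suc; *-identityʳ; *-comm;
         *-monoʳ-≤; m^n>0; <⇒≱; ≤-refl; ≤-trans; ≤-reflexive; <-≤-trans; module ≤-Reasoning)
open import Data.Nat.ListAction using (sum)
open import Data.Bool using (true; false; _∧_; if_then_else_)
open import Data.Fin using (Fin; zero; suc; _≟_)
open import Data.List using (List; []; _∷_; length; map; _++_; allFin)
open import Data.List.Properties using (length-map; length-++; length-tabulate)
open import Data.List.Relation.Unary.All as All using (All; []; _∷_)
import Data.List.Relation.Unary.All.Properties as All
open import Data.List.Relation.Unary.AllPairs as AllPairs using (AllPairs; []; _∷_)
import Data.List.Relation.Unary.AllPairs.Properties as AllPairs
open import Data.Product using (_,_)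
open import Data.Empty using (⊥-elim)
open import Relation.Nullary using (¬_; yes; no; does)
open import Relation.Binary.PropositionalEquality

one two : Fin 3
one = suc zero
two = suc (suc zero)

sum-map-≤ : ∀ {A : Set} (h : A → ℕ) (c : ℕ) → (∀ x → h x ≤ c) →
  (xs : List A) → sum (map h xs) ≤ length xs * c
sum-map-≤ h c h≤c []       = z≤n
sum-map-≤ h c h≤c (x ∷ xs) = +-mono-≤ (h≤c x) (sum-map-≤ h c h≤c xs)

2^suc : ∀ n → 2 ^ suc n ≡ 2 ^ n + 2 ^ n
2^suc n = cong (2 ^ n +_) (+-identityʳ (2 ^ n))

n<2^n : ∀ n → n < 2 ^ n
n<2^n zero    = s≤s z≤n
n<2^n (suc n) = begin-strict
  suc n          <⟨ +-monoʳ-< 1 (n<2^n n) ⟩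
  1 + 2 ^ n      ≤⟨ +-monoˡ-≤ (2 ^ n) (m^n>0 2 n) ⟩
  2 ^ n + 2 ^ n  ≡⟨ sym (2^suc n) ⟩
  2 ^ suc n      ∎
  where open ≤-Reasoning

ZeroFree : ∀ {n} → Labeling n → Set
ZeroFree f = ∀ v → ¬ f v ≡ zero

twoNeighbours≤order : ∀ {n} (G : Graph n) f v → twoNeighbours G f v ≤ n
twoNeighbours≤order {n} G f v = begin
  twoNeighbours G f v       ≤⟨ sum-map-≤ _ 1 indicator≤1 (allFin n) ⟩
  length (allFin n) * 1     ≡⟨ *-identityʳ _ ⟩
  length (allFin n)         ≡⟨ length-tabulate (λ u → u) ⟩
  n                         ∎
  where
  open ≤-Reasoning
  indicator≤1 : ∀ u → (if adj G v u ∧ isTwo (f u) then 1 else 0) ≤ 1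
  indicator≤1 u with adj G v u ∧ isTwo (f u)
  ... | true  = ≤-refl
  ... | false = z≤n

-- For k larger than the order, the domination condition can never be met,
-- so every RkDF is zero-free ...
RkDF⇒zeroFree : ∀ {n} k (G : Graph n) f → n < k → IsRkDF k G f → ZeroFree f
RkDF⇒zeroFree k G f n<k rkdf v fv≡0 =
  <⇒≱ n<k (≤-trans (rkdf v fv≡0) (twoNeighbours≤order G f v))

zeroFree⇒RkDF : ∀ {n} k (G : Graph n) f → ZeroFree f → IsRkDF k G f
zeroFree⇒RkDF k G f zf v fv≡0 = ⊥-elim (zf v fv≡0)

restrict : ∀ {n} → Labeling (suc n) → Labeling n
restrict f v = f (suc v)

withHead : ∀ {n} → Fin 3 → List (Labeling (suc n)) → List (Labeling n)
withHead c [] = []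
withHead c (f ∷ fs) =
  if does (f zero ≟ c) then restrict f ∷ withHead c fs else withHead c fs

withHead-covers : ∀ {n} (fs : List (Labeling (suc n))) → All ZeroFree fs →
  length fs ≤ length (withHead one fs) + length (withHead two fs)
withHead-covers []       []         = z≤n
withHead-covers (f ∷ fs) (zf ∷ zfs) with f zero in f0≡
... | zero           = ⊥-elim (zf zero f0≡)
... | suc zero       = s≤s (withHead-covers fs zfs)
... | suc (suc zero) =
  ≤-trans (s≤s (withHead-covers fs zfs)) (≤-reflexive (sym (+-suc _ _)))

withHead-zeroFree : ∀ {n} c (fs : List (Labeling (suc n))) → All ZeroFree fs →
  All ZeroFree (withHead c fs)
withHead-zeroFree c []       []         = []
withHead-zeroFree c (f ∷ fs) (zf ∷ zfs) with f zero ≟ c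
... | yes _ = (λ v → zf (suc v)) ∷ withHead-zeroFree c fs zfs
... | no  _ = withHead-zeroFree c fs zfs

withHead-distinct : ∀ {n} c (f : Labeling (suc n)) → f zero ≡ c →
  (gs : List (Labeling (suc n))) →
  All (Distinct f) gs → All (Distinct (restrict f)) (withHead c gs)
withHead-distinct c f f0≡c []       []         = []
withHead-distinct c f f0≡c (g ∷ gs) (d ∷ ds) with g zero ≟ c | d
... | no  _    | _             = withHead-distinct c f f0≡c gs ds
... | yes g0≡c | zero  , f≢g  = ⊥-elim (f≢g (trans f0≡c (sym g0≡c)))
... | yes _    | suc v , f≢g  = (v , f≢g) ∷ withHead-distinct c f f0≡c gs ds

withHead-pairwise : ∀ {n} c (fs : List (Labeling (suc n))) →
  AllPairs Distinct fs → AllPairs Distinct (withHead c fs)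
withHead-pairwise c []       []       = []
withHead-pairwise c (f ∷ fs) (d ∷ ds) with f zero ≟ c
... | yes f0≡c = withHead-distinct c f f0≡c fs d ∷ withHead-pairwise c fs ds
... | no  _    = withHead-pairwise c fs ds

zeroFree-family-bound : ∀ n (fs : List (Labeling n)) → All ZeroFree fs →
  AllPairs Distinct fs → length fs ≤ 2 ^ n
zeroFree-family-bound zero    []           _ _ = z≤n
zeroFree-family-bound zero    (f ∷ [])     _ _ = s≤s z≤n
zeroFree-family-bound zero    (f ∷ g ∷ fs) _ (((() , _) ∷ _) ∷ _)
zeroFree-family-bound (suc n) fs zfs ds = begin
  length fs                                         ≤⟨ withHead-covers fs zfs ⟩
  length (withHead one fs) + length (withHead two fs) ≤⟨ +-mono-≤ (part one) (part two) ⟩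
  2 ^ n + 2 ^ n                                     ≡⟨ sym (2^suc n) ⟩
  2 ^ suc n                                         ∎
  where
  open ≤-Reasoning
  part : ∀ c → length (withHead c fs) ≤ 2 ^ n
  part c = zeroFree-family-bound n (withHead c fs)
             (withHead-zeroFree c fs zfs) (withHead-pairwise c fs ds)

extend : ∀ {n} → Fin 3 → Labeling n → Labeling (suc n)
extend c f zero    = c
extend c f (suc v) = f v

zeroFreeLabelings : ∀ n → List (Labeling n)
zeroFreeLabelings zero    = (λ ()) ∷ []
zeroFreeLabelings (suc n) =
  map (extend one) (zeroFreeLabelings n) ++ map (extend two) (zeroFreeLabelings n)

zeroFreeLabelings-length : ∀ n → length (zeroFreeLabelings n) ≡ 2 ^ n
zeroFreeLabelings-length zero    = refl
zeroFreeLabelings-length (suc n) = begin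
  length (map (extend one) Ls ++ map (extend two) Ls)
    ≡⟨ length-++ (map (extend one) Ls) ⟩
  length (map (extend one) Ls) + length (map (extend two) Ls)
    ≡⟨ cong₂ _+_ (length-map _ Ls) (length-map _ Ls) ⟩
  length Ls + length Ls
    ≡⟨ cong₂ _+_ (zeroFreeLabelings-length n) (zeroFreeLabelings-length n) ⟩
  2 ^ n + 2 ^ n
    ≡⟨ sym (2^suc n) ⟩
  2 ^ suc n ∎
  where
  open ≡-Reasoning
  Ls : List (Labeling n)
  Ls = zeroFreeLabelings n

zeroFreeLabelings-zeroFree : ∀ n → All ZeroFree (zeroFreeLabelings n)
zeroFreeLabelings-zeroFree zero    = (λ ()) ∷ []
zeroFreeLabelings-zeroFree (suc n) =
  All.++⁺ (All.map⁺ (All.map (extend-zeroFree one (λ ())) IH))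
          (All.map⁺ (All.map (extend-zeroFree two (λ ())) IH))
  where
  IH : All ZeroFree (zeroFreeLabelings n)
  IH = zeroFreeLabelings-zeroFree n
  extend-zeroFree : ∀ c {f : Labeling n} → ¬ c ≡ zero → ZeroFree f → ZeroFree (extend c f)
  extend-zeroFree c c≢0 zf zero    = c≢0
  extend-zeroFree c c≢0 zf (suc v) = zf v

zeroFreeLabelings-pairwise : ∀ n → AllPairs Distinct (zeroFreeLabelings n)
zeroFreeLabelings-pairwise zero    = [] ∷ []
zeroFreeLabelings-pairwise (suc n) =
  AllPairs.++⁺ (AllPairs.map⁺ (AllPairs.map extend-distinct IH))
               (AllPairs.map⁺ (AllPairs.map extend-distinct IH))
               (All.map⁺ (All.universal ones≢twos Ls))
  where
  Ls : List (Labeling n)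
  Ls = zeroFreeLabelings n
  IH : AllPairs Distinct Ls
  IH = zeroFreeLabelings-pairwise n
  extend-distinct : ∀ {c} {f g : Labeling n} → Distinct f g → Distinct (extend c f) (extend c g)
  extend-distinct (v , f≢g) = suc v , f≢g
  ones≢twos : ∀ f → All (Distinct (extend one f)) (map (extend two) Ls)
  ones≢twos f = All.map⁺ (All.universal (λ g → zero , λ ()) Ls)

val≤2 : ∀ x → val x ≤ 2
val≤2 zero             = z≤n
val≤2 (suc zero)       = s≤s z≤n
val≤2 (suc (suc zero)) = ≤-refl

zeroFreeLabelings-family : ∀ k n (G : Graph n) → 2 ^ n ≤ k →
  IsRkkFamily k G (zeroFreeLabelings n)
zeroFreeLabelings-family k n G 2^n≤k =
  All.map (zeroFree⇒RkDF k G _) (zeroFreeLabelings-zeroFree n) ,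
  zeroFreeLabelings-pairwise n ,
  vertexSum≤2k
  where
  Ls : List (Labeling n)
  Ls = zeroFreeLabelings n
  vertexSum≤2k : ∀ v → sum (map (λ f → val (f v)) Ls) ≤ 2 * k
  vertexSum≤2k v = begin
    sum (map (λ f → val (f v)) Ls) ≤⟨ sum-map-≤ _ 2 (λ f → val≤2 (f v)) Ls ⟩
    length Ls * 2                  ≡⟨ cong (_* 2) (zeroFreeLabelings-length n) ⟩
    2 ^ n * 2                      ≡⟨ *-comm (2 ^ n) 2 ⟩
    2 * 2 ^ n                      ≤⟨ *-monoʳ-≤ 2 2^n≤k ⟩
    2 * k                          ∎
    where open ≤-Reasoning

mainTheorem18 : (k n : ℕ) → 1 ≤ k → (G : Graph n) →
    2 ^ n ≤ k → RomanKKDomaticNumberIs k G (2 ^ n)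
mainTheorem18 k n _ G 2^n≤k =
  (zeroFreeLabelings n , zeroFreeLabelings-family k n G 2^n≤k ,
   zeroFreeLabelings-length n) ,
  familyBound
  where
  n<k : n < k
  n<k = <-≤-trans (n<2^n n) 2^n≤k
  familyBound : ∀ fs → IsRkkFamily k G fs → length fs ≤ 2 ^ n
  familyBound fs (rkdfs , distinct , _) =
    zeroFree-family-bound n fs (All.map (RkDF⇒zeroFree k G _ n<k) rkdfs) distinct
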